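{- Let $f:\mathbb{B}^n\to\mathbb{B}^n$ be a Boolean network in which component $n$ is not autoregulated, let $P\in\{0,1,\star\}^n$ be a phenotype subspace with $P_n=\star$, and let $S\in\{0,1,\star\}^{n-1}$ be an MTS-control strategy for $(\tilde f,P_{[n-1]})$. Suppose that, for each minimal trap space $T$ of $C(f,S^{\star})$, $T_{[n-1]}$ is a minimal trap space of $\widetilde{C(f,S^{\star})}$. Then $S^{\star}$ is an MTS-control strategy for $(f,P)$.
   Context: $\mathbb{B}=\{0,1\}$, $[n]=\{1,\dots,n\}$. For $x\in\mathbb{B}^n$, $\bar x^i$ is $x$ with coordinate $i$ flipped. Component $i$ regulates $j$ if $g_j(x)\neq g_j(\bar x^i)$ for some $x$ (for a network $g$); $n$ is autoregulated if it regulates itself. A subspace is a set $\{x: x_i=c(i)\ \forall i\in I\}$, written as $S\in\{0,1,\star\}^m$ with $S_i=c(i)$ on $I$ (fixed) and $\star$ elsewhere (free); $A_J$ is projection onto coordinates $J$; for $A\subseteq\mathbb{B}^{n-1}$, $A^{\star}=\{x\in\mathbb{B}^n: x_{[n-1]}\in A\}$. A trap space of $g$ is a subspace $T$ with $g(T)\subseteq T$; minimal if no trap space is strictly contained in it. Reduction of $g$ (with $n$ not autoregulated): $\sigma(x)=(x,g_n(x,0))$ and $\tilde g_i(x)=g_i(\sigma(x))$ for $x\in\mathbb{B}^{n-1}$, $i\in[n-1]$. Control: $C(g,S)_i=g_i$ if $i$ is free in $S$ and $C(g,S)_i\equiv S_i$ if $i$ is fixed in $S$. A subspace $S$ is an MTS-control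 strategy for $(g,P)$ if all minimal trap spaces of $C(g,S)$ are contained in $P$. -}

module Defs where

open import Data.Bool using (Bool; true; false; not)
open import Data.Maybe using (Maybe; just; nothing)
open import Data.Fin using (Fin; zero; suc; fromℕ; inject₁; _≟_)
open import Data.Nat using (ℕ; zero; suc)
open import Data.Product using (∃; _×_)
open import Relation.Binary.PropositionalEquality using (_≡_; _≢_)
open import Relation.Nullary using (¬_; yes; no)

State : ℕ → Set
State k = Fin k → Bool

Network : ℕ → Set
Network k = State k → State k

-- Subspaces S ∈ {0,1,⋆}^k : nothing = ⋆ (free), just b = fixed to b.
Subspace : ℕ → Set
Subspace k = Fin k → Maybe Bool

-- Append a last coordinate (coordinate n = fromℕ m in Fin (suc m)).
snoc : ∀ {A : Set} {m} → (Fin m → A) → A → Fin (suc m) → A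
snoc {m = zero}  x a zero    = a
snoc {m = suc m} x a zero    = x zero
snoc {m = suc m} x a (suc i) = snoc (λ j → x (suc j)) a i

init : ∀ {A : Set} {m} → (Fin (suc m) → A) → Fin m → A
init x i = x (inject₁ i)

flipAt : ∀ {k} → State k → Fin k → State k
flipAt x i j with j ≟ i
... | yes _ = not (x j)
... | no  _ = x j

Regulates : ∀ {k} → Network k → Fin k → Fin k → Set
Regulates g i j = ∃ λ x → g x j ≢ g (flipAt x i) j

_∈S_ : ∀ {k} → State k → Subspace k → Set
x ∈S S = ∀ i b → S i ≡ just b → x i ≡ b

_⊆S_ : ∀ {k} → Subspace k → Subspace k → Set
S ⊆S T = ∀ x → x ∈S S → x ∈S T

TrapSpace : ∀ {k} → Network k → Subspace k → Set
TrapSpace g T = ∀ x → x ∈S T → g x ∈S T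

MinTrapSpace : ∀ {k} → Network k → Subspace k → Set
MinTrapSpace g T =
  TrapSpace g T × (∀ T′ → TrapSpace g T′ → T′ ⊆S T → T ⊆S T′)

Control : ∀ {k} → Network k → Subspace k → Network k
Control g S x i with S i
... | nothing = g x i
... | just b  = b

MTSControl : ∀ {k} → Network k → Subspace k → Subspace k → Set
MTSControl g S P = ∀ T → MinTrapSpace g′ T → T ⊆S P
  where g′ = Control g S

σ : ∀ {m} → Network (suc m) → State m → State (suc m)
σ {m} g x = snoc x (g (snoc x false) (fromℕ m))

reduce : ∀ {m} → Network (suc m) → Network m
reduce g x i = g (σ g x) (inject₁ i)

_⋆ : ∀ {m} → Subspace m → Subspace (suc m)
S ⋆ = snoc S nothing

-- Fixing the last component through S ⋆ leaves it free, so eliminating it commutes with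
-- control: reducing C(f, S ⋆) gives exactly C(f̃, S). A minimal trap space T of C(f, S ⋆)
-- therefore projects to a minimal trap space of C(f̃, S), which lies in P restricted to
-- [n-1] because S controls f̃; and since P leaves the last coordinate free, T lies in P.
module Submission where

open import Defs
open import Data.Nat using (ℕ; suc; zero)
open import Data.Fin using (Fin; fromℕ; inject₁; zero; suc)
open import Data.Maybe using (nothing; just)
open import Data.Bool using (false)
open import Data.Product using (_,_)
open import Relation.Binary.PropositionalEquality
  using (_≡_; _≗_; refl; sym; trans; cong)
open import Relation.Nullary using (¬_)

snoc-fromℕ : ∀ {A : Set} m (x : Fin m → A) a → snoc x a (fromℕ m) ≡ a
snoc-fromℕ zero    x a = refl
snoc-fromℕ (suc m) x a = snoc-fromℕ m (λ j → x (suc j)) a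

snoc-inject₁ : ∀ {A : Set} m (x : Fin m → A) a i → snoc x a (inject₁ i) ≡ x i
snoc-inject₁ (suc m) x a zero    = refl
snoc-inject₁ (suc m) x a (suc i) = snoc-inject₁ m (λ j → x (suc j)) a i

data LastOrInject₁ : ∀ {m} → Fin (suc m) → Set where
  last    : ∀ {m} → LastOrInject₁ (fromℕ m)
  injected : ∀ {m} (j : Fin m) → LastOrInject₁ (inject₁ j)

lastOrInject₁ : ∀ {m} (i : Fin (suc m)) → LastOrInject₁ i
lastOrInject₁ {zero}  zero    = last
lastOrInject₁ {suc m} zero    = injected zero
lastOrInject₁ {suc m} (suc i) with lastOrInject₁ i
... | last      = last
... | injected j = injected (suc j)

Control-free : ∀ {k} (g : Network k) S x i → S i ≡ nothing → Control g S x i ≡ g x i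
Control-free g S x i eq with S i
Control-free g S x i refl | nothing = refl

Control-fixed : ∀ {k} (g : Network k) S x i b → S i ≡ just b → Control g S x i ≡ b
Control-fixed g S x i b eq with S i
Control-fixed g S x i b refl | just .b = refl

TrapSpace-resp-≗ : ∀ {k} {g h : Network k} → (∀ x → g x ≗ h x) →
  ∀ T → TrapSpace g T → TrapSpace h T
TrapSpace-resp-≗ g≗h T trapT x x∈T i b Ti≡b = trans (sym (g≗h x i)) (trapT x x∈T i b Ti≡b)

MinTrapSpace-resp-≗ : ∀ {k} {g h : Network k} → (∀ x → g x ≗ h x) →
  ∀ T → MinTrapSpace g T → MinTrapSpace h T
MinTrapSpace-resp-≗ g≗h T (trapT , minT) =
  TrapSpace-resp-≗ g≗h T trapT ,
  λ T′ trapT′ T′⊆T → minT T′ (TrapSpace-resp-≗ (λ x i → sym (g≗h x i)) T′ trapT′) T′⊆T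

reduce-Control-⋆ : ∀ m (f : Network (suc m)) (S : Subspace m) x →
  reduce (Control f (S ⋆)) x ≗ Control (reduce f) S x
reduce-Control-⋆ m f S x i
  rewrite Control-free f (S ⋆) (snoc x false) (fromℕ m) (snoc-fromℕ m S nothing)
  = controlled (S i) refl
  where
  controlled : ∀ s → S i ≡ s → Control f (S ⋆) (σ f x) (inject₁ i) ≡ Control (reduce f) S x i
  controlled nothing  Si≡s =
    trans (Control-free f (S ⋆) _ _ (trans (snoc-inject₁ m S nothing i) Si≡s))
          (sym (Control-free (reduce f) S x i Si≡s))
  controlled (just b) Si≡s =
    trans (Control-fixed f (S ⋆) _ _ b (trans (snoc-inject₁ m S nothing i) Si≡s))
          (sym (Control-fixed (reduce f) S x i b Si≡s))

∈S-init : ∀ {m} {x : State (suc m)} {T : Subspace (suc m)} → x ∈S T → init x ∈S init T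
∈S-init x∈T i = x∈T (inject₁ i)

⊆S-from-init : ∀ {m} {T P : Subspace (suc m)} → P (fromℕ m) ≡ nothing →
  init T ⊆S init P → T ⊆S P
⊆S-from-init Pn≡⋆ T⊆P x x∈T i b Pi≡b with lastOrInject₁ i
... | last with trans (sym Pn≡⋆) Pi≡b
...   | ()
⊆S-from-init Pn≡⋆ T⊆P x x∈T i b Pi≡b | injected j =
  T⊆P (init x) (∈S-init x∈T) j b Pi≡b

-- Non-autoregulation of the last component is what makes the reduction meaningful in the
-- paper; the containment argument itself does not use it.
proposition4 : (m : ℕ) (f : Network (suc m)) (P : Subspace (suc m)) (S : Subspace m) →
    ¬ Regulates f (fromℕ m) (fromℕ m) →
    P (fromℕ m) ≡ nothing →
    MTSControl (reduce f) S (init P) →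
    (∀ T → MinTrapSpace (Control f (S ⋆)) T →
      MinTrapSpace (reduce (Control f (S ⋆))) (init T)) →
    MTSControl f (S ⋆) P
proposition4 m f P S _ Pn≡⋆ controlsReduced reducesMinimal T minT =
  ⊆S-from-init Pn≡⋆
    (controlsReduced (init T)
      (MinTrapSpace-resp-≗ (reduce-Control-⋆ m f S) (init T) (reducesMinimal T minT)))
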